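{- Let $a<b$ be positive integers with $a\neq1$ odd and $b$ even. Then there is no infinite smooth word over $\{a,b\}$ that is an infinite Lyndon word.
   Context: Words over $\{a,b\}$ are compared lexicographically with $a<b$. For a word $w$ over $\{a,b\}$ written as maximal blocks $\alpha_0^{i_0}\alpha_1^{i_1}\cdots$ ($\alpha_{k+1}\ne\alpha_k$, $i_k\ge1$), $\Delta(w)=i_0i_1\cdots$. An infinite word $w\in\{a,b\}^\omega$ is smooth if $\Delta^k(w)\in\{a,b\}^\omega$ for all $k\ge0$. An infinite Lyndon word is an infinite word strictly smaller than each of its proper suffixes. -}

module Defs where

open import Data.Nat using (ℕ; zero; suc; _+_; _<_; _≤_)
open import Data.Product using (Σ; _×_; ∃)
open import Data.Sum using (_⊎_)
open import Relation.Binary.PropositionalEquality using (_≡_; _≢_)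

Word : Set
Word = ℕ → ℕ

OverAB : ℕ → ℕ → Word → Set
OverAB a b w = ∀ n → (w n ≡ a) ⊎ (w n ≡ b)

blockStart : Word → ℕ → ℕ
blockStart d zero    = 0
blockStart d (suc k) = blockStart d k + d k

-- IsDelta w d : d = Δ(w), i.e. w = α₀^{d 0} α₁^{d 1} ⋯ written as
-- maximal blocks, with infinitely many blocks (each of length ≥ 1).
IsDelta : Word → Word → Set
IsDelta w d =
  (∀ k → 1 ≤ d k) ×
  (∀ k j → j < d k → w (blockStart d k + j) ≡ w (blockStart d k)) ×
  (∀ k → w (blockStart d (suc k)) ≢ w (blockStart d k))

Smooth : ℕ → ℕ → Word → Set
Smooth a b w = Σ (ℕ → Word) λ W →
  (∀ n → W 0 n ≡ w n) ×
  (∀ k → OverAB a b (W k)) ×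
  (∀ k → IsDelta (W k) (W (suc k)))

_<lex_ : Word → Word → Set
u <lex v = ∃ λ n → (∀ m → m < n → u m ≡ v m) × (u n < v n)

suffix : ℕ → Word → Word
suffix i w n = w (i + n)

InfLyndon : Word → Set
InfLyndon w = ∀ i → 1 ≤ i → w <lex suffix i w

-- Let w be a smooth Lyndon word with Δw = d, Δd = e, Δe = f, Δf = g; all letters are ≥ 2 since
-- a ≥ 3. Comparing w with suitable suffixes shows that w begins with a, that d begins with b b,
-- and that d has no factor b a starting at a positive even position. Hence the a-blocks of d
-- start at even positions, so every b-block of d and the a-block after it have
-- even total length e(2t+1) + e(2t+2); as a is odd and b even, e(2t+1) = e(2t+2). Then no block
-- of e starts at a positive even position, i.e. f(0) and f(0) + f(1) are odd, which contradicts
-- f(1) = f(0) (the first block of f has length g(0) ≥ 2).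
module Submission where

open import Defs
open import Data.Nat using (ℕ; _<_; _≤_; zero; suc; _+_; _*_; s≤s; _<?_)
open import Data.Nat.Properties
open import Data.Nat.Divisibility using (_∣_; divides; ∣m+n∣m⇒∣n)
open import Data.Product using (∃; _×_; _,_; proj₁; proj₂)
open import Data.Sum using (_⊎_; inj₁; inj₂)
open import Data.Empty using (⊥-elim)
open import Function using (_∘_)
open import Relation.Nullary using (¬_; yes; no)
open import Relation.Binary using (tri<; tri≈; tri>)
open import Relation.Binary.PropositionalEquality

even⊎odd : ∀ n → (∃ λ q → n ≡ q * 2) ⊎ (∃ λ q → n ≡ suc (q * 2))
even⊎odd zero = inj₁ (0 , refl)
even⊎odd (suc n) with even⊎odd n
... | inj₁ (q , n≡2q)   = inj₂ (q , cong suc n≡2q)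
... | inj₂ (q , n≡2q+1) = inj₁ (suc q , cong suc n≡2q+1)

<lex-asym : ∀ {u v} → u <lex v → ¬ (v <lex u)
<lex-asym (n , u≡v , uₙ<vₙ) (n′ , v≡u , vₙ′<uₙ′) with <-cmp n n′
... | tri< n<n′ _ _ = <-irrefl (sym (v≡u n n<n′)) uₙ<vₙ
... | tri≈ _ refl _ = <-asym uₙ<vₙ vₙ′<uₙ′
... | tri> _ _ n′<n = <-irrefl (sym (u≡v n′ n′<n)) vₙ′<uₙ′

<lex-resp : ∀ {u u′ v v′} → u ≗ u′ → v ≗ v′ → u <lex v → u′ <lex v′
<lex-resp u≗u′ v≗v′ (n , u≡v , uₙ<vₙ) =
  n , (λ m m<n → trans (sym (u≗u′ m)) (trans (u≡v m m<n) (v≗v′ m)))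
    , subst₂ _<_ (u≗u′ n) (v≗v′ n) uₙ<vₙ

InfLyndon-resp : ∀ {u v} → u ≗ v → InfLyndon u → InfLyndon v
InfLyndon-resp u≗v lyn i i≥1 = <lex-resp u≗v (u≗v ∘ (i +_)) (lyn i i≥1)

InfLyndon⇒¬suffix<lex : ∀ {w} → InfLyndon w → ∀ i → 1 ≤ i → ¬ (suffix i w <lex w)
InfLyndon⇒¬suffix<lex lyn i i≥1 = <lex-asym (lyn i i≥1)

module _ {a b : ℕ} {u : Word} (ov : OverAB a b u) where

  switch-from-a : ∀ {m n} → u m ≡ a → u n ≢ u m → u n ≡ b
  switch-from-a {n = n} uₘ≡a uₙ≢uₘ with ov n
  ... | inj₁ uₙ≡a = ⊥-elim (uₙ≢uₘ (trans uₙ≡a (sym uₘ≡a)))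
  ... | inj₂ uₙ≡b = uₙ≡b

  switch-from-b : ∀ {m n} → u m ≡ b → u n ≢ u m → u n ≡ a
  switch-from-b {n = n} uₘ≡b uₙ≢uₘ with ov n
  ... | inj₁ uₙ≡a = uₙ≡a
  ... | inj₂ uₙ≡b = ⊥-elim (uₙ≢uₘ (trans uₙ≡b (sym uₘ≡b)))

module _ {a b : ℕ} (a-odd : ¬ 2 ∣ a) (b-even : 2 ∣ b) where

  even-sum⇒≡ : ∀ {x y} → x ≡ a ⊎ x ≡ b → y ≡ a ⊎ y ≡ b → 2 ∣ x + y → x ≡ y
  even-sum⇒≡ (inj₁ refl) (inj₁ refl) _ = refl
  even-sum⇒≡ (inj₂ refl) (inj₂ refl) _ = refl
  even-sum⇒≡ (inj₁ refl) (inj₂ refl) 2∣a+b =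
    ⊥-elim (a-odd (∣m+n∣m⇒∣n (subst (2 ∣_) (+-comm a b) 2∣a+b) b-even))
  even-sum⇒≡ (inj₂ refl) (inj₁ refl) 2∣b+a = ⊥-elim (a-odd (∣m+n∣m⇒∣n 2∣b+a b-even))

module Blocks {u D : Word} (isd : IsDelta u D) where

  bs : ℕ → ℕ
  bs = blockStart D

  block-constant : ∀ k j → j < D k → u (bs k + j) ≡ u (bs k)
  block-constant = proj₁ (proj₂ isd)

  letter-changes : ∀ k → u (bs (suc k)) ≢ u (bs k)
  letter-changes = proj₂ (proj₂ isd)

  D0≤bs : ∀ k → D 0 ≤ bs (suc k)
  D0≤bs zero    = ≤-refl
  D0≤bs (suc k) = ≤-trans (D0≤bs k) (m≤m+n _ _)

  boundary-changes : ∀ k {p} → bs (suc k) ≡ suc p → u (suc p) ≢ u p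
  boundary-changes k {p} bs≡1+p u₁₊ₚ≡uₚ with m≤n⇒∃[o]m+o≡n (proj₁ isd k)
  ... | j , 1+j≡Dk = letter-changes k (begin
      u (bs (suc k)) ≡⟨ cong u bs≡1+p ⟩
      u (suc p)      ≡⟨ u₁₊ₚ≡uₚ ⟩
      u p            ≡⟨ cong u p≡bs+j ⟩
      u (bs k + j)   ≡⟨ block-constant k j (subst (j <_) 1+j≡Dk ≤-refl) ⟩
      u (bs k)       ∎)
    where
    open ≡-Reasoning
    p≡bs+j : p ≡ bs k + j
    p≡bs+j = suc-injective
      (trans (sym bs≡1+p) (trans (cong (bs k +_) (sym 1+j≡Dk)) (+-suc (bs k) j)))

  alternation : ∀ {x y} →
    (∀ k → u (bs k) ≡ x → u (bs (suc k)) ≡ y) → (∀ k → u (bs k) ≡ y → u (bs (suc k)) ≡ x) →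
    u 0 ≡ x → ∀ q → u (bs (q * 2)) ≡ x × u (bs (suc (q * 2))) ≡ y
  alternation x→y y→x u₀≡x zero    = u₀≡x , x→y 0 u₀≡x
  alternation x→y y→x u₀≡x (suc q) =
    let even≡x = y→x _ (proj₂ (alternation x→y y→x u₀≡x q)) in even≡x , x→y _ even≡x

  module _ {a b : ℕ} (ov : OverAB a b u) where

    next-after-a : ∀ k → u (bs k) ≡ a → u (bs (suc k)) ≡ b
    next-after-a k uₖ≡a = switch-from-a ov uₖ≡a (letter-changes k)

    next-after-b : ∀ k → u (bs k) ≡ b → u (bs (suc k)) ≡ a
    next-after-b k uₖ≡b = switch-from-b ov uₖ≡b (letter-changes k)

    blocks-from-a : u 0 ≡ a → ∀ q → u (bs (q * 2)) ≡ a × u (bs (suc (q * 2))) ≡ b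
    blocks-from-a = alternation next-after-a next-after-b

    blocks-from-b : u 0 ≡ b → ∀ q → u (bs (q * 2)) ≡ b × u (bs (suc (q * 2))) ≡ a
    blocks-from-b = alternation next-after-b next-after-a

module _ {e f : Word} (isd : IsDelta e f) (paired : ∀ t → e (suc (t * 2)) ≡ e (suc (suc (t * 2)))) where
  open Blocks {e} {f} isd

  paired⇒¬even-boundary : ∀ k t → bs (suc k) ≢ suc t * 2
  paired⇒¬even-boundary k t bs≡2t+2 = boundary-changes k bs≡2t+2 (sym (paired t))

  paired⇒f1≢f0 : f 1 ≢ f 0
  paired⇒f1≢f0 f1≡f0 with even⊎odd (f 0)
  ... | inj₁ (zero , f0≡0)        = <-irrefl (sym f0≡0) (proj₁ isd 0)
  ... | inj₁ (suc t , f0≡2t+2)    = paired⇒¬even-boundary 0 t f0≡2t+2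
  ... | inj₂ (q , f0≡2q+1)        = paired⇒¬even-boundary 1 (q + q) (begin
      f 0 + f 1                 ≡⟨ cong (f 0 +_) f1≡f0 ⟩
      f 0 + f 0                 ≡⟨ cong₂ _+_ f0≡2q+1 f0≡2q+1 ⟩
      suc (q * 2) + suc (q * 2) ≡⟨ cong suc (+-suc (q * 2) (q * 2)) ⟩
      suc (suc (q * 2 + q * 2)) ≡⟨ cong (suc ∘ suc) (sym (*-distribʳ-+ 2 q q)) ⟩
      suc (q + q) * 2           ∎)
    where open ≡-Reasoning

module SmoothLyndon {a b : ℕ} (a<b : a < b) (2≤a : 2 ≤ a) (a-odd : ¬ 2 ∣ a) (b-even : 2 ∣ b)
    (W : ℕ → Word) (ov : ∀ k → OverAB a b (W k)) (isd : ∀ k → IsDelta (W k) (W (suc k)))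
    (lyn : InfLyndon (W 0)) where

  u d e : Word
  u = W 0
  d = W 1
  e = W 2

  module U = Blocks {u} {d} (isd 0)
  module D = Blocks {d} {e} (isd 1)

  letter≥2 : ∀ k n → 2 ≤ W k n
  letter≥2 k n with ov k n
  ... | inj₁ ≡a = subst (2 ≤_) (sym ≡a) 2≤a
  ... | inj₂ ≡b = subst (2 ≤_) (sym ≡b) (≤-trans 2≤a (<⇒≤ a<b))

  u0≡a : u 0 ≡ a
  u0≡a with ov 0 0
  ... | inj₁ u0≡a = u0≡a
  ... | inj₂ u0≡b =
    ⊥-elim (InfLyndon⇒¬suffix<lex lyn (d 0) (proj₁ (isd 0) 0) (0 , (λ _ ()) , smaller))
    where
    smaller : u (d 0 + 0) < u 0
    smaller = subst₂ _<_
      (sym (trans (cong u (+-identityʳ (d 0))) (U.next-after-b (ov 0) 0 u0≡b))) (sym u0≡b) a<b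

  -- An a-block of length b > a contains a^(a+1), which beats the prefix a^a b of u.
  d0≡a⇒d[2q+2]≢b : d 0 ≡ a → ∀ q → d (suc q * 2) ≢ b
  d0≡a⇒d[2q+2]≢b d0≡a q dₙ≡b = InfLyndon⇒¬suffix<lex lyn i i≥1 (a , agree , smaller)
    where
    n p r i : ℕ
    n = suc q * 2
    p = U.bs n
    r = proj₁ (m≤n⇒∃[o]m+o≡n a<b)
    i = p + r
    1+a+r≡b : suc a + r ≡ b
    1+a+r≡b = proj₂ (m≤n⇒∃[o]m+o≡n a<b)
    i≥1 : 1 ≤ i
    i≥1 = ≤-trans (proj₁ (isd 0) 0) (≤-trans (U.D0≤bs (suc (q * 2))) (m≤m+n p r))
    inside : ∀ m → m ≤ a → suffix i u m ≡ a
    inside m m≤a = trans (cong u (+-assoc p r m))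
      (trans (U.block-constant n (r + m) r+m<dₙ) (proj₁ (U.blocks-from-a (ov 0) u0≡a (suc q))))
      where
      r+m<dₙ : r + m < d n
      r+m<dₙ = subst (r + m <_) (trans (trans (cong suc (+-comm r a)) 1+a+r≡b) (sym dₙ≡b))
                 (s≤s (+-monoʳ-≤ r m≤a))
    agree : ∀ m → m < a → suffix i u m ≡ u m
    agree m m<a = trans (inside m (<⇒≤ m<a))
      (sym (trans (U.block-constant 0 m (subst (m <_) (sym d0≡a) m<a)) u0≡a))
    smaller : suffix i u a < u a
    smaller = subst₂ _<_ (sym (inside a ≤-refl))
      (sym (subst (λ x → u x ≡ b) d0≡a (U.next-after-a (ov 0) 0 u0≡a))) a<b

  -- The first b-block of d starts at e 0 ≥ 2 and has length ≥ 2, so it covers an even position.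
  d0≢a : d 0 ≢ a
  d0≢a d0≡a with even⊎odd (e 0)
  ... | inj₁ (zero , e0≡0)     = <-irrefl (sym e0≡0) (proj₁ (isd 1) 0)
  ... | inj₁ (suc q , e0≡2q+2) =
    d0≡a⇒d[2q+2]≢b d0≡a q (subst (λ x → d x ≡ b) e0≡2q+2 (D.next-after-a (ov 1) 0 d0≡a))
  ... | inj₂ (q , e0≡2q+1)     = d0≡a⇒d[2q+2]≢b d0≡a q
    (trans (cong d (trans (cong suc (sym e0≡2q+1)) (+-comm 1 (e 0))))
      (trans (D.block-constant 1 1 (letter≥2 2 1)) (D.next-after-a (ov 1) 0 d0≡a)))

  d0≡b : d 0 ≡ b
  d0≡b with ov 1 0
  ... | inj₁ d0≡a = ⊥-elim (d0≢a d0≡a)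
  ... | inj₂ d0≡b = d0≡b

  d1≡b : d 1 ≡ b
  d1≡b = trans (D.block-constant 0 1 (letter≥2 2 0)) d0≡b

  -- u begins with a^b b^b, whereas its a-block number 2q+2 is followed by b^a a.
  d[2q+2]≡b⇒d[2q+3]≢a : ∀ q → d (suc q * 2) ≡ b → d (suc (suc q * 2)) ≢ a
  d[2q+2]≡b⇒d[2q+3]≢a q dₙ≡b dₙ₊₁≡a =
    InfLyndon⇒¬suffix<lex lyn p p≥1 (b + a , agree , smaller)
    where
    n p : ℕ
    n = suc q * 2
    p = U.bs n
    p≥1 : 1 ≤ p
    p≥1 = ≤-trans (proj₁ (isd 0) 0) (U.D0≤bs (suc (q * 2)))
    u-first : ∀ m → m < b → u m ≡ a
    u-first m m<b = trans (U.block-constant 0 m (subst (m <_) (sym d0≡b) m<b)) u0≡a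
    u-second : ∀ j → j < b → u (b + j) ≡ b
    u-second j j<b = subst (λ x → u (x + j) ≡ b) d0≡b
      (trans (U.block-constant 1 j (subst (j <_) (sym d1≡b) j<b)) (U.next-after-a (ov 0) 0 u0≡a))
    suffix-first : ∀ m → m < b → u (p + m) ≡ a
    suffix-first m m<b = trans (U.block-constant n m (subst (m <_) (sym dₙ≡b) m<b))
      (proj₁ (U.blocks-from-a (ov 0) u0≡a (suc q)))
    suffix-second : ∀ j → j < a → u (p + (b + j)) ≡ b
    suffix-second j j<a =
      trans (cong u (trans (sym (+-assoc p b j)) (cong (λ x → p + x + j) (sym dₙ≡b))))
        (trans (U.block-constant (suc n) j (subst (j <_) (sym dₙ₊₁≡a) j<a))
          (proj₂ (U.blocks-from-a (ov 0) u0≡a (suc q))))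
    agree : ∀ m → m < b + a → suffix p u m ≡ u m
    agree m m<b+a with m <? b
    ... | yes m<b = trans (suffix-first m m<b) (sym (u-first m m<b))
    ... | no m≮b with m≤n⇒∃[o]m+o≡n (≮⇒≥ m≮b)
    ...   | j , refl = trans (suffix-second j j<a) (sym (u-second j (<-trans j<a a<b)))
      where
      j<a : j < a
      j<a = +-cancelˡ-< b j a m<b+a
    smaller : suffix p u (b + a) < u (b + a)
    smaller = subst₂ _<_ (sym suffix-third) (sym (u-second a a<b)) a<b
      where
      suffix-third : u (p + (b + a)) ≡ a
      suffix-third =
        trans (cong u (trans (sym (+-assoc p b a))
                             (cong₂ (λ x y → p + x + y) (sym dₙ≡b) (sym dₙ₊₁≡a))))
          (proj₁ (U.blocks-from-a (ov 0) u0≡a (suc (suc q))))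

  a-block-of-d-starts-even : ∀ t → 2 ∣ D.bs (suc (t * 2))
  a-block-of-d-starts-even t with even⊎odd (D.bs (suc (t * 2)))
  ... | inj₁ (q , bs≡2q)         = divides q bs≡2q
  ... | inj₂ (zero , bs≡1)       =
    ⊥-elim (<-irrefl refl (subst (2 ≤_) bs≡1 (≤-trans (letter≥2 2 0) (D.D0≤bs (t * 2)))))
  ... | inj₂ (suc k , bs≡2k+3)   = ⊥-elim (d[2q+2]≡b⇒d[2q+3]≢a k dₚ≡b dₚ₊₁≡a)
    where
    dₚ₊₁≡a : d (suc (suc k * 2)) ≡ a
    dₚ₊₁≡a = trans (cong d (sym bs≡2k+3)) (proj₂ (D.blocks-from-b (ov 1) d0≡b t))
    dₚ≡b : d (suc k * 2) ≡ b
    dₚ≡b = switch-from-a (ov 1) dₚ₊₁≡a (≢-sym (D.boundary-changes (t * 2) bs≡2k+3))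

  e-paired : ∀ t → e (suc (t * 2)) ≡ e (suc (suc (t * 2)))
  e-paired t = even-sum⇒≡ a-odd b-even (ov 2 _) (ov 2 _)
    (∣m+n∣m⇒∣n (subst (2 ∣_) (+-assoc (D.bs (suc (t * 2))) _ _) (a-block-of-d-starts-even (suc t)))
               (a-block-of-d-starts-even t))

theorem30 : (a b : ℕ) → 1 ≤ a → a < b → a ≢ 1 → ¬ (2 ∣ a) → 2 ∣ b →
    ¬ (∃ λ w → Smooth a b w × InfLyndon w)
theorem30 a b 1≤a a<b a≢1 a-odd b-even (w , (W , W₀≗w , ov , isd) , lyn) =
  paired⇒f1≢f0 {W 2} {W 3} (isd 2) e-paired
    (Blocks.block-constant {W 3} {W 4} (isd 3) 0 1 (letter≥2 4 0))
  where
  open SmoothLyndon a<b (≤∧≢⇒< 1≤a (≢-sym a≢1)) a-odd b-even W ov isd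
         (InfLyndon-resp (sym ∘ W₀≗w) lyn)
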